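{- Let $X_1,\ldots,X_n$ be connected graphs, $X_i=(\Omega_i,E_i)$, and let $X=X_1\,\square\cdots\square\,X_n$. For $i\in\{1,\ldots,n\}$ let $c_i=1_{\Omega_1}\otimes\cdots\otimes 1_{\Omega_{i-1}}\otimes E_i\otimes 1_{\Omega_{i+1}}\otimes\cdots\otimes 1_{\Omega_n}$ and let $\langle c_i\rangle$ be the equivalence relation on $\Omega_1\times\cdots\times\Omega_n$ generated by $c_i$. Then $$\mathrm{WL}(X)=\mathrm{WL}(X_1)\otimes\cdots\otimes\mathrm{WL}(X_n)$$ if and only if $\langle c_i\rangle$ is a parabolic of $\mathrm{WL}(X)$ for each $i$.
   Context: Graphs are finite simple undirected. For relations $s_i\subseteq\Omega_i^2$, $s_1\otimes\cdots\otimes s_n=\{(\alpha,\beta)\in(\Omega_1\times\cdots\times\Omega_n)^2:(\alpha_i,\beta_i)\in s_i\ \forall i\}$; $1_{\Omega_i}$ is the diagonal of $\Omega_i^2$. The Cartesian product $X_1\,\square\cdots\square\,X_n$ has vertex set $\Omega_1\times\cdots\times\Omega_n$ and edge set $c_1\cup\cdots\cup c_n$. A coherent configuration on a finite set $\Omega$ is $(\Omega,S)$ with $S$ a partition of $\Omega^2$ (basis relations) such that $1_\Omega$ is a union of basis relations, $S$ is closed under transposition, and for $r,s,t\in S$ the number $|\{\gamma:(\alpha,\gamma)\in r,(\gamma,\beta)\in s\}|$ is constant over $(\alpha,\beta)\in t$; relations are unions of basis relations. $\mathrm{WL}(X)$ is the smallest coherent configuration on the vertex set of $X$ having the edge set as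 a relation. The tensor product of coherent configurations $(\Omega_i,S_i)$ is the coherent configuration on $\Omega_1\times\cdots\times\Omega_n$ with basis relations $s_1\otimes\cdots\otimes s_n$, $s_i\in S_i$. A parabolic of a coherent configuration on $\Omega$ is an equivalence relation on $\Omega$ that is a relation (union of basis relations) of it. -}

module Defs where

open import Data.Nat using (ℕ; zero; suc; _+_)
open import Data.Fin using (Fin; zero; suc; _≟_)
open import Data.Bool using (Bool; true; false; if_then_else_; _∧_)
open import Data.Unit using (⊤; tt)
open import Data.Product using (Σ; _×_; _,_; ∃)
open import Relation.Nullary using (¬_; ⌊_⌋)
open import Relation.Binary.PropositionalEquality using (_≡_)
open import Relation.Binary.Structures using (IsEquivalence)
open import Relation.Binary.Construct.Closure.ReflexiveTransitive using (Star)
open import Relation.Binary.Construct.Closure.Equivalence using (EqClosure)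

record Graph : Set₁ where
  field
    size   : ℕ
    E      : Fin size → Fin size → Set
    sym    : ∀ a b → E a b → E b a
    irrefl : ∀ a → ¬ E a a
open Graph public

Connected : Graph → Set
Connected X = ∀ a b → Star (E X) a b

sumFin : (N : ℕ) → (Fin N → ℕ) → ℕ
sumFin zero    f = 0
sumFin (suc N) f = f zero + sumFin N (λ i → f (suc i))

countFin : (N : ℕ) → (Fin N → Bool) → ℕ
countFin N p = sumFin N (λ i → if p i then 1 else 0)

Vtx : (n : ℕ) → (Fin n → Graph) → Set
Vtx zero    X = ⊤
Vtx (suc n) X = Fin (size (X zero)) × Vtx n (λ i → X (suc i))

proj : ∀ {n} {X : Fin n → Graph} → Vtx n X → (i : Fin n) → Fin (size (X i))
proj {suc n} (a , r) zero    = a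
proj {suc n} (a , r) (suc i) = proj r i

countVtx : (n : ℕ) (X : Fin n → Graph) → (Vtx n X → Bool) → ℕ
countVtx zero    X p = if p tt then 1 else 0
countVtx (suc n) X p =
  sumFin (size (X zero)) (λ a → countVtx n (λ i → X (suc i)) (λ r → p (a , r)))

c : ∀ {n} (X : Fin n → Graph) → (i : Fin n) → Vtx n X → Vtx n X → Set
c X i α β = E (X i) (proj α i) (proj β i)
          × (∀ j → ¬ j ≡ i → proj α j ≡ proj β j)

BoxEdges : ∀ {n} (X : Fin n → Graph) → Vtx n X → Vtx n X → Set
BoxEdges X α β = ∃ λ i → c X i α β

-- The partition S of A² into basis relations is given by a surjective
-- colouring col : A → A → Fin k (the classes are the basis relations).

record CC (A : Set) (count : (A → Bool) → ℕ) : Set where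
  field
    k      : ℕ
    col    : A → A → Fin k
    surj   : ∀ r → Σ A λ a → Σ A λ b → col a b ≡ r
    -- 1_A is a union of basis relations
    diag   : ∀ a b d → col a a ≡ col b d → b ≡ d
    transp : ∀ a b a' b' → col a b ≡ col a' b' → col b a ≡ col b' a'
    regular : ∀ (r s : Fin k) a b a' b' → col a b ≡ col a' b' →
      count (λ γ → ⌊ col a γ ≟ r ⌋ ∧ ⌊ col γ b ≟ s ⌋)
        ≡ count (λ γ → ⌊ col a' γ ≟ r ⌋ ∧ ⌊ col γ b' ≟ s ⌋)
open CC public

-- R is a relation of the CC, i.e. a union of basis relations
IsRelation : ∀ {A count} → CC A count → (A → A → Set) → Set
IsRelation C R = ∀ a b a' b' → col C a b ≡ col C a' b' → R a b → R a' b'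

-- C = WL(E): the smallest coherent configuration having E as a relation
-- (every relation of C is a relation of any CC having E as a relation)
IsWL : ∀ {A count} → CC A count → (A → A → Set) → Set₁
IsWL {A} {count} C E' =
  IsRelation C E' ×
  ((D : CC A count) → IsRelation D E' →
     (R : A → A → Set) → IsRelation C R → IsRelation D R)

IsParabolic : ∀ {A count} → CC A count → (A → A → Set) → Set
IsParabolic C R = IsEquivalence R × IsRelation C R

-- C equals (as a set of basis relations) the tensor product of the Cᵢ,
-- whose basis relations are s₁ ⊗ ⋯ ⊗ sₙ (sᵢ basis relations of Cᵢ)
TensorEq : ∀ {n} {X : Fin n → Graph} →
  CC (Vtx n X) (countVtx n X) →
  ((i : Fin n) → CC (Fin (size (X i))) (countFin (size (X i)))) → Set
TensorEq {n} {X} C Cs = ∀ (α β α' β' : Vtx n X) →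
  (col C α β ≡ col C α' β' →
     ∀ i → col (Cs i) (proj α i) (proj β i) ≡ col (Cs i) (proj α' i) (proj β' i))
  × ((∀ i → col (Cs i) (proj α i) (proj β i) ≡ col (Cs i) (proj α' i) (proj β' i))
     → col C α β ≡ col C α' β')

{-# OPTIONS --safe #-}

-- (⇒) In a tensor product the colour of (α, β) fixes, for every j, whether α_j = β_j. Since
-- X_i is connected, ⟨c_i⟩ is the relation "α_j = β_j for all j ≠ i", hence a union of basis
-- relations.
-- (⇐) The tensor product of the WL(X_i) is a coherent configuration having the edge set of X as
-- a relation, so by minimality each basis relation of WL(X) is a union of tensor basis relations.
-- Conversely, the parabolics ⟨c_j⟩, j ≠ i, generate the parabolic "α_i = β_i". The quotient of
-- WL(X) by it is a coherent configuration on Ω_i having E_i as a relation, because c_i is a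
-- relation of WL(X). Minimality of WL(X_i) then shows that the colour of (α, β) in WL(X)
-- determines the colour of (α_i, β_i) in WL(X_i).

module Submission where

open import Defs
open import Data.Nat using (ℕ)
open import Data.Fin using (Fin)
open import Function.Bundles using (_⇔_)
open import Relation.Binary.Construct.Closure.Equivalence using (EqClosure)

open import Algebra.Bundles using (CommutativeMonoid)
open import Axiom.UniquenessOfIdentityProofs using (module Decidable⇒UIP)
open import Data.Bool using (Bool; true; false; if_then_else_; _∧_)
open import Data.Bool.Properties using (∧-commutativeMonoid; ∧-identityʳ)
open import Data.Empty using (⊥-elim)
open import Data.Fin using (zero; suc; _≟_; inject₁; combine)
open import Data.Fin.Properties
  using (suc-injective; inject₁-injective; any?; combine-injective; combine-surjective)
open import Data.List using (List; _∷_; filter; length; lookup; allFin)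
open import Data.List.Membership.Propositional using (_∈_)
open import Data.List.Membership.Propositional.Properties
  using (∈-filter⁺; ∈-filter⁻; ∈-allFin; ∈-lookup)
open import Data.List.Membership.Setoid.Properties using (unique⇒irrelevant)
open import Data.List.Relation.Unary.Any using (index)
open import Data.List.Relation.Unary.Any.Properties using (lookup-index)
open import Data.List.Relation.Unary.Unique.Propositional.Properties using (filter⁺; allFin⁺)
open import Data.Nat using (zero; suc; _+_; _*_; _<_; NonZero; >-nonZero; z<s)
open import Data.Nat.Properties
  using ( +-identityʳ; *-comm; *-assoc; *-distribʳ-+; *-cancelˡ-≡; m*n≢0⇒m≢0
        ; ≤-trans; m≤m+n; m≤n+m; +-commutativeSemigroup )
open import Data.Product using (∃; ∃₂; _×_; _,_; proj₁; proj₂)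
open import Data.Unit using (tt)
open import Function using (_∘_; _$′_; id)
open import Function.Bundles using (Equivalence; mk⇔)
open import Relation.Binary.Construct.Closure.Equivalence using (isEquivalence)
open import Relation.Binary.Construct.Closure.ReflexiveTransitive
  using (Star; ε; _◅_; _◅◅_; gmap)
open import Relation.Binary.Construct.Closure.Symmetric using (fwd; bwd)
open import Relation.Binary.PropositionalEquality
  using (_≡_; _≢_; refl; trans; cong; cong₂; subst; subst₂; setoid; module ≡-Reasoning)
  renaming (sym to ≡-sym)
open import Relation.Nullary using (Dec; yes; no; ⌊_⌋)
open import Relation.Nullary.Decidable using (map′; _×-dec_)
open import Relation.Unary using (Decidable)

open import Algebra.Properties.CommutativeSemigroup +-commutativeSemigroup
  using () renaming (interchange to +-interchange)
open import Algebra.Properties.CommutativeSemigroup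
  (CommutativeMonoid.commutativeSemigroup ∧-commutativeMonoid)
  using () renaming (interchange to ∧-interchange; x∙yz≈z∙yx to ∧-rotate)

iverson : Bool → ℕ
iverson b = if b then 1 else 0

isYes-sound : {A : Set} (a? : Dec A) → ⌊ a? ⌋ ≡ true → A
isYes-sound (yes a) _ = a
isYes-sound (no _)  ()

isYes-complete : {A : Set} (a? : Dec A) → A → ⌊ a? ⌋ ≡ true
isYes-complete (yes _) _ = refl
isYes-complete (no ¬a) a = ⊥-elim (¬a a)

isYes-cong : {A B : Set} (a? : Dec A) (b? : Dec B) → A ⇔ B → ⌊ a? ⌋ ≡ ⌊ b? ⌋
isYes-cong (yes _) (yes _)  _   = refl
isYes-cong (no _)  (no _)   _   = refl
isYes-cong (yes a) (no ¬b) A⇔B = ⊥-elim (¬b (Equivalence.to A⇔B a))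
isYes-cong (no ¬a) (yes b) A⇔B = ⊥-elim (¬a (Equivalence.from A⇔B b))

isYes-×-dec : {A B : Set} (a? : Dec A) (b? : Dec B) → ⌊ a? ×-dec b? ⌋ ≡ ⌊ a? ⌋ ∧ ⌊ b? ⌋
isYes-×-dec (yes _) (yes _) = refl
isYes-×-dec (yes _) (no _)  = refl
isYes-×-dec (no _)  _       = refl

isYes-∧-sound : {A B : Set} (a? : Dec A) (b? : Dec B) → ⌊ a? ⌋ ∧ ⌊ b? ⌋ ≡ true → A × B
isYes-∧-sound a? b? = isYes-sound (a? ×-dec b?) ∘ trans (isYes-×-dec a? b?)

≟-refl : ∀ {N} (x : Fin N) → ⌊ x ≟ x ⌋ ≡ true
≟-refl x = isYes-complete (x ≟ x) refl

suc-≟ : ∀ {N} (x y : Fin N) → ⌊ suc x ≟ suc y ⌋ ≡ ⌊ x ≟ y ⌋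
suc-≟ x y = isYes-cong (suc x ≟ suc y) (x ≟ y) (mk⇔ suc-injective (cong suc))

combine-≟ : ∀ {m n} (x x' : Fin m) (y y' : Fin n) →
  ⌊ combine x y ≟ combine x' y' ⌋ ≡ ⌊ x ≟ x' ⌋ ∧ ⌊ y ≟ y' ⌋
combine-≟ x x' y y' =
  trans (isYes-cong (combine x y ≟ combine x' y') (x ≟ x' ×-dec y ≟ y')
                    (mk⇔ (combine-injective x y x' y') λ { (refl , refl) → refl }))
        (isYes-×-dec (x ≟ x') (y ≟ y'))

least : ∀ {K} {P : Fin K → Set} → Decidable P → Fin (suc K)
least {zero}  P? = zero
least {suc K} P? = if ⌊ P? zero ⌋ then zero else suc (least (P? ∘ suc))

least-cong : ∀ {K} {P Q : Fin K → Set} (P? : Decidable P) (Q? : Decidable Q) →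
  (∀ u → P u ⇔ Q u) → least P? ≡ least Q?
least-cong {zero}  P? Q? P⇔Q = refl
least-cong {suc K} P? Q? P⇔Q =
  cong₂ (λ b r → if b then zero else suc r)
        (isYes-cong (P? zero) (Q? zero) (P⇔Q zero))
        (least-cong (P? ∘ suc) (Q? ∘ suc) (P⇔Q ∘ suc))

least-satisfies : ∀ {K} {P : Fin K → Set} (P? : Decidable P) {u} → P u →
  ∃ λ v → least P? ≡ inject₁ v × P v
least-satisfies {suc K} P? {u} Pu with P? zero
... | yes P0 = zero , refl , P0
least-satisfies {suc K} P? {zero}  P0 | no ¬P0 = ⊥-elim (¬P0 P0)
least-satisfies {suc K} P? {suc u} Pu | no _   =
  let v , least≡v , Pv = least-satisfies (P? ∘ suc) Pu in suc v , cong suc least≡v , Pv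

sumFin-cong : ∀ N {f g : Fin N → ℕ} → (∀ a → f a ≡ g a) → sumFin N f ≡ sumFin N g
sumFin-cong zero    f≗g = refl
sumFin-cong (suc N) f≗g = cong₂ _+_ (f≗g zero) (sumFin-cong N (f≗g ∘ suc))

sumFin-zero : ∀ N → sumFin N (λ _ → 0) ≡ 0
sumFin-zero zero    = refl
sumFin-zero (suc N) = sumFin-zero N

sumFin-const : ∀ N m → sumFin N (λ _ → m) ≡ N * m
sumFin-const zero    m = refl
sumFin-const (suc N) m = cong (m +_) (sumFin-const N m)

sumFin-+ : ∀ N (f g : Fin N → ℕ) → sumFin N (λ a → f a + g a) ≡ sumFin N f + sumFin N g
sumFin-+ zero    f g = refl
sumFin-+ (suc N) f g =
  trans (cong (f zero + g zero +_) (sumFin-+ N (f ∘ suc) (g ∘ suc)))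
        (+-interchange (f zero) (g zero) _ _)

sumFin-*ʳ : ∀ N (f : Fin N → ℕ) m → sumFin N (λ a → f a * m) ≡ sumFin N f * m
sumFin-*ʳ zero    f m = refl
sumFin-*ʳ (suc N) f m =
  trans (cong (f zero * m +_) (sumFin-*ʳ N (f ∘ suc) m)) (≡-sym (*-distribʳ-+ m (f zero) _))

sumFin-swap : ∀ N M (F : Fin N → Fin M → ℕ) →
  sumFin N (λ a → sumFin M (F a)) ≡ sumFin M (λ b → sumFin N (λ a → F a b))
sumFin-swap zero    M F = ≡-sym (sumFin-zero M)
sumFin-swap (suc N) M F =
  trans (cong (sumFin M (F zero) +_) (sumFin-swap N M (F ∘ suc)))
        (≡-sym (sumFin-+ M (F zero) _))

sumFin-positive : ∀ N (f : Fin N → ℕ) a → 0 < f a → 0 < sumFin N f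
sumFin-positive (suc N) f zero    0<fa = ≤-trans 0<fa (m≤m+n (f zero) _)
sumFin-positive (suc N) f (suc a) 0<fa =
  ≤-trans (sumFin-positive N (f ∘ suc) a 0<fa) (m≤n+m _ (f zero))

sumFin-witness : ∀ N (f : Fin N → ℕ) → 0 < sumFin N f → ∃ λ a → 0 < f a
sumFin-witness (suc N) f 0<Σf with f zero in eq
... | suc _ = zero , subst (0 <_) (≡-sym eq) z<s
... | zero  = let a , 0<fa = sumFin-witness N (f ∘ suc) 0<Σf in suc a , 0<fa

sumFin-delta : ∀ N (x : Fin N) (q : Fin N → Bool) →
  sumFin N (λ r → iverson (⌊ x ≟ r ⌋ ∧ q r)) ≡ iverson (q x)
sumFin-delta (suc N) zero    q =
  trans (cong (iverson (q zero) +_) (sumFin-zero N)) (+-identityʳ _)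
sumFin-delta (suc N) (suc x) q =
  trans (sumFin-cong N λ r → cong (λ b → iverson (b ∧ q (suc r))) (suc-≟ x r))
        (sumFin-delta N x (q ∘ suc))

countVtx-cong : ∀ n X {p q : Vtx n X → Bool} → (∀ γ → p γ ≡ q γ) →
  countVtx n X p ≡ countVtx n X q
countVtx-cong zero    X p≗q = cong iverson (p≗q tt)
countVtx-cong (suc n) X p≗q = sumFin-cong _ λ a → countVtx-cong n (X ∘ suc) (p≗q ∘ (a ,_))

countVtx-positive : ∀ n X (p : Vtx n X → Bool) γ → p γ ≡ true → 0 < countVtx n X p
countVtx-positive zero    X p tt      pγ rewrite pγ = z<s
countVtx-positive (suc n) X p (a , γ) pγ =
  sumFin-positive _ _ a (countVtx-positive n (X ∘ suc) _ γ pγ)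

countVtx-witness : ∀ n X (p : Vtx n X → Bool) → 0 < countVtx n X p → ∃ λ γ → p γ ≡ true
countVtx-witness zero X p 0<#p with p tt in eq
... | true = tt , eq
countVtx-witness (suc n) X p 0<#p =
  let a , 0<#pa = sumFin-witness _ _ 0<#p
      γ , pγ    = countVtx-witness n (X ∘ suc) _ 0<#pa
  in (a , γ) , pγ

countVtx-false : ∀ n X → countVtx n X (λ _ → false) ≡ 0
countVtx-false zero    X = refl
countVtx-false (suc n) X =
  trans (sumFin-cong (size (X zero)) λ _ → countVtx-false n (X ∘ suc))
        (sumFin-zero (size (X zero)))

countVtx-∧ˡ : ∀ n X b (q : Vtx n X → Bool) →
  countVtx n X (λ γ → b ∧ q γ) ≡ iverson b * countVtx n X q
countVtx-∧ˡ n X true  q = ≡-sym (+-identityʳ _)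
countVtx-∧ˡ n X false q = countVtx-false n X

countVtx-const : ∀ n X b → countVtx n X (λ _ → b) ≡ iverson b * countVtx n X (λ _ → true)
countVtx-const n X b =
  trans (countVtx-cong n X λ _ → ≡-sym (∧-identityʳ b)) (countVtx-∧ˡ n X b (λ _ → true))

countVtx-split : ∀ n X K (f : Vtx n X → Fin K) (Q : Vtx n X → Fin K → Bool) →
  countVtx n X (λ γ → Q γ (f γ))
  ≡ sumFin K (λ r → countVtx n X (λ γ → ⌊ f γ ≟ r ⌋ ∧ Q γ r))
countVtx-split zero    X K f Q = ≡-sym (sumFin-delta K (f tt) (Q tt))
countVtx-split (suc n) X K f Q =
  trans (sumFin-cong _ λ a → countVtx-split n (X ∘ suc) K (f ∘ (a ,_)) (Q ∘ (a ,_)))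
        (sumFin-swap (size (X zero)) K _)

fibreSize : ∀ n (X : Fin n → Graph) → Fin n → ℕ
fibreSize (suc n) X zero    = countVtx n (X ∘ suc) (λ _ → true)
fibreSize (suc n) X (suc i) = size (X zero) * fibreSize n (X ∘ suc) i

countVtx-proj : ∀ n X i (p : Fin (size (X i)) → Bool) →
  countVtx n X (λ γ → p (proj γ i)) ≡ fibreSize n X i * countFin (size (X i)) p
countVtx-proj (suc n) X zero p = begin
  sumFin N (λ a → countVtx n (X ∘ suc) (λ _ → p a))
    ≡⟨ sumFin-cong N (λ a → countVtx-const n (X ∘ suc) (p a)) ⟩
  sumFin N (λ a → iverson (p a) * fibreSize (suc n) X zero)
    ≡⟨ sumFin-*ʳ N (iverson ∘ p) _ ⟩
  countFin N p * fibreSize (suc n) X zero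
    ≡⟨ *-comm (countFin N p) _ ⟩
  fibreSize (suc n) X zero * countFin N p ∎
  where open ≡-Reasoning
        N = size (X zero)
countVtx-proj (suc n) X (suc i) p = begin
  sumFin N (λ _ → countVtx n (X ∘ suc) (λ γ → p (proj γ i)))
    ≡⟨ sumFin-cong N (λ _ → countVtx-proj n (X ∘ suc) i p) ⟩
  sumFin N (λ _ → fibreSize n (X ∘ suc) i * countFin (size (X (suc i))) p)
    ≡⟨ sumFin-const N _ ⟩
  N * (fibreSize n (X ∘ suc) i * countFin (size (X (suc i))) p)
    ≡⟨ ≡-sym (*-assoc N _ _) ⟩
  fibreSize (suc n) X (suc i) * countFin (size (X (suc i))) p ∎
  where open ≡-Reasoning
        N = size (X zero)

fibreSize-nonZero : ∀ n X i → Vtx n X → NonZero (fibreSize n X i)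
fibreSize-nonZero n X i γ = m*n≢0⇒m≢0 (fibreSize n X i) {{>-nonZero 0<fibreSize*size}}
  where
    0<fibreSize*size : 0 < fibreSize n X i * countFin (size (X i)) (λ _ → true)
    0<fibreSize*size =
      subst (0 <_) (countVtx-proj n X i (λ _ → true)) (countVtx-positive n X _ γ refl)

∃Vtx? : ∀ {n} {X : Fin n → Graph} {P : Vtx n X → Set} → Decidable P → Dec (∃ P)
∃Vtx? {zero}  P? = map′ (tt ,_) proj₂ (P? tt)
∃Vtx? {suc n} P? = map′ (λ (a , γ , p) → (a , γ) , p) (λ ((a , γ) , p) → a , γ , p)
                        (any? λ a → ∃Vtx? (P? ∘ (a ,_)))

update : ∀ {n} {X : Fin n → Graph} → Vtx n X → (i : Fin n) → Fin (size (X i)) → Vtx n X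
update {suc n}     (_ , γ) zero    a = a , γ
update {suc n} {X} (b , γ) (suc i) a = b , update {X = X ∘ suc} γ i a

proj-update-≡ : ∀ {n} {X : Fin n → Graph} (γ : Vtx n X) i a → proj (update γ i a) i ≡ a
proj-update-≡ {suc n}     _       zero    a = refl
proj-update-≡ {suc n} {X} (_ , γ) (suc i) a = proj-update-≡ {X = X ∘ suc} γ i a

proj-update-≢ : ∀ {n} {X : Fin n → Graph} (γ : Vtx n X) i a j → j ≢ i →
  proj (update γ i a) j ≡ proj γ j
proj-update-≢ {suc n}     _       zero    a zero    0≢0 = ⊥-elim (0≢0 refl)
proj-update-≢ {suc n}     _       zero    a (suc j) _   = refl
proj-update-≢ {suc n}     _       (suc i) a zero    _   = refl
proj-update-≢ {suc n} {X} (_ , γ) (suc i) a (suc j) j≢i =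
  proj-update-≢ {X = X ∘ suc} γ i a j (j≢i ∘ cong suc)

proj-ext : ∀ {n} {X : Fin n → Graph} {α β : Vtx n X} →
  (∀ j → proj α j ≡ proj β j) → α ≡ β
proj-ext {zero}      _   = refl
proj-ext {suc n} {X} α≗β = cong₂ _,_ (α≗β zero) (proj-ext {X = X ∘ suc} (α≗β ∘ suc))

AgreeOff : ∀ {n} (X : Fin n → Graph) → Fin n → Vtx n X → Vtx n X → Set
AgreeOff X i α β = ∀ j → j ≢ i → proj α j ≡ proj β j

update-agreeOff : ∀ {n} {X : Fin n → Graph} {i} {α β : Vtx n X} →
  AgreeOff X i α β → update α i (proj β i) ≡ β
update-agreeOff {i = i} {α} {β} α≈β = proj-ext λ j → agree j (j ≟ i)
  where
    agree : ∀ j → Dec (j ≡ i) → proj (update α i (proj β i)) j ≡ proj β j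
    agree j (yes refl) = proj-update-≡ α i (proj β i)
    agree j (no j≢i)   = trans (proj-update-≢ α i (proj β i) j j≢i) (α≈β j j≢i)

update-c : ∀ {n} {X : Fin n → Graph} (γ : Vtx n X) i {a b} → E (X i) a b →
  c X i (update γ i a) (update γ i b)
update-c {X = X} γ i {a} {b} ab =
  subst₂ (E (X i)) (≡-sym (proj-update-≡ γ i a)) (≡-sym (proj-update-≡ γ i b)) ab ,
  λ j j≢i → trans (proj-update-≢ γ i a j j≢i) (≡-sym (proj-update-≢ γ i b j j≢i))

update-Star : ∀ {n} {X : Fin n → Graph} (γ : Vtx n X) i {a b} → Star (E (X i)) a b →
  EqClosure (c X i) (update γ i a) (update γ i b)
update-Star γ i ε          = ε
update-Star γ i (ab ◅ b~c) = fwd (update-c γ i ab) ◅ update-Star γ i b~c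

EqClosure-c⇒AgreeOff : ∀ {n} {X : Fin n → Graph} {i α β} →
  EqClosure (c X i) α β → AgreeOff X i α β
EqClosure-c⇒AgreeOff ε                      j j≢i = refl
EqClosure-c⇒AgreeOff (fwd (_ , α≈γ) ◅ γ~β) j j≢i =
  trans (α≈γ j j≢i) (EqClosure-c⇒AgreeOff γ~β j j≢i)
EqClosure-c⇒AgreeOff (bwd (_ , γ≈α) ◅ γ~β) j j≢i =
  trans (≡-sym (γ≈α j j≢i)) (EqClosure-c⇒AgreeOff γ~β j j≢i)

AgreeOff⇒EqClosure-c : ∀ {n} {X : Fin n → Graph} {i α β} → Connected (X i) →
  AgreeOff X i α β → EqClosure (c X i) α β
AgreeOff⇒EqClosure-c {X = X} {i} {α} {β} conn α≈β =
  subst₂ (EqClosure (c X i)) (update-agreeOff (λ _ _ → refl)) (update-agreeOff α≈β)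
         (update-Star α i (conn (proj α i) (proj β i)))

SingleStepBetween : ∀ {n} (X : Fin n → Graph) (α β : Vtx n X) → Vtx n X → Vtx n X → Set
SingleStepBetween X α β x y = ∃ λ j → proj α j ≢ proj β j × AgreeOff X j x y

coordinatewise-path : ∀ n (X : Fin n → Graph) (α β : Vtx n X) →
  Star (SingleStepBetween X α β) α β
coordinatewise-path zero    X α β = ε
coordinatewise-path (suc n) X (a , α) (b , β) =
  gmap (a ,_) lift-step (coordinatewise-path n (X ∘ suc) α β) ◅◅ first-step (a ≟ b)
  where
    lift-step : ∀ {x y} → SingleStepBetween (X ∘ suc) α β x y →
      SingleStepBetween X (a , α) (b , β) (a , x) (a , y)
    lift-step (j , αⱼ≢βⱼ , x≈y) =
      suc j , αⱼ≢βⱼ , λ { zero _ → refl ; (suc l) l≢j → x≈y l (l≢j ∘ cong suc) }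
    first-step : Dec (a ≡ b) → Star (SingleStepBetween X (a , α) (b , β)) (a , β) (b , β)
    first-step (yes refl) = ε
    first-step (no a≢b)   =
      (zero , a≢b , λ { zero 0≢0 → ⊥-elim (0≢0 refl) ; (suc l) _ → refl }) ◅ ε

IsRelation-map : ∀ {A count} (C : CC A count) {R R' : A → A → Set} →
  (∀ {x y} → R x y → R' x y) → (∀ {x y} → R' x y → R x y) →
  IsRelation C R → IsRelation C R'
IsRelation-map C R⇒R' R'⇒R R-rel x y x' y' e = R⇒R' ∘ R-rel x y x' y' e ∘ R'⇒R

SameColourAs : ∀ {A count} (C : CC A count) → A → A → A → A → Set
SameColourAs C x y u v = col C u v ≡ col C x y

SameColourAs-isRelation : ∀ {A count} (C : CC A count) x y → IsRelation C (SameColourAs C x y)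
SameColourAs-isRelation C x y u v u' v' e uv~xy = trans (≡-sym e) uv~xy

WL-refines : ∀ {A count} (C D : CC A count) {R : A → A → Set} → IsWL C R → IsRelation D R →
  ∀ x y x' y' → col D x y ≡ col D x' y' → col C x y ≡ col C x' y'
WL-refines C D (_ , minimal) R∈D x y x' y' e =
  ≡-sym (minimal D R∈D (SameColourAs C x y) (SameColourAs-isRelation C x y) x y x' y' e refl)

module _ {n} {X : Fin n → Graph} (C : CC (Vtx n X) (countVtx n X)) where

  same-colour-triangle : ∀ α β α' β' → col C α β ≡ col C α' β' → ∀ γ →
    ∃ λ γ' → col C α' γ' ≡ col C α γ × col C γ' β' ≡ col C γ β
  same-colour-triangle α β α' β' e γ =
    let γ' , found = countVtx-witness n X _ (subst (0 <_) (regular C r s α β α' β' e) γ-counted)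
    in γ' , isYes-∧-sound (col C α' γ' ≟ r) (col C γ' β' ≟ s) found
    where
      r = col C α γ
      s = col C γ β
      γ-counted : 0 < countVtx n X (λ δ → ⌊ col C α δ ≟ r ⌋ ∧ ⌊ col C δ β ≟ s ⌋)
      γ-counted = countVtx-positive n X _ γ (cong₂ _∧_ (≟-refl r) (≟-refl s))

  Star-isRelation : ∀ {R} → IsRelation C R → IsRelation C (Star R)
  Star-isRelation R-rel α .α α' β' e ε = subst (Star _ α') (diag C α α' β' e) ε
  Star-isRelation R-rel α β α' β' e (_◅_ {j = γ} αγ γβ) =
    let γ' , α'γ'≡αγ , γ'β'≡γβ = same-colour-triangle α β α' β' e γ
    in R-rel α γ α' γ' (≡-sym α'γ'≡αγ) αγ
       ◅ Star-isRelation R-rel γ β γ' β' (≡-sym γ'β'≡γβ) γβ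

  regular-by-colours : ∀ α β α' β' → col C α β ≡ col C α' β' →
    (H : Fin (k C) → Fin (k C) → Bool) →
    countVtx n X (λ γ → H (col C α γ) (col C γ β))
    ≡ countVtx n X (λ γ → H (col C α' γ) (col C γ β'))
  regular-by-colours α β α' β' e H =
    trans (by-colours α β)
          (trans (sumFin-cong (k C) λ r → sumFin-cong (k C) λ s →
                    cong (iverson (H r s) *_) (regular C r s α β α' β' e))
                 (≡-sym (by-colours α' β')))
    where
      by-colours : ∀ α β → countVtx n X (λ γ → H (col C α γ) (col C γ β)) ≡
        sumFin (k C) λ r → sumFin (k C) λ s →
          iverson (H r s) * countVtx n X (λ γ → ⌊ col C α γ ≟ r ⌋ ∧ ⌊ col C γ β ≟ s ⌋)
      by-colours α β = begin
        countVtx n X (λ γ → H (col C α γ) (col C γ β))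
          ≡⟨ countVtx-split n X (k C) (col C α) (λ γ r → H r (col C γ β)) ⟩
        sumFin (k C) (λ r → countVtx n X λ γ → ⌊ col C α γ ≟ r ⌋ ∧ H r (col C γ β))
          ≡⟨ sumFin-cong (k C) (λ r → countVtx-split n X (k C) (λ γ → col C γ β)
                                                      (λ γ s → ⌊ col C α γ ≟ r ⌋ ∧ H r s)) ⟩
        sumFin (k C) (λ r → sumFin (k C) λ s →
          countVtx n X λ γ → ⌊ col C γ β ≟ s ⌋ ∧ (⌊ col C α γ ≟ r ⌋ ∧ H r s))
          ≡⟨ sumFin-cong (k C) (λ r → sumFin-cong (k C) λ s →
               trans (countVtx-cong n X λ γ →
                        ∧-rotate ⌊ col C γ β ≟ s ⌋ ⌊ col C α γ ≟ r ⌋ (H r s))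
                     (countVtx-∧ˡ n X (H r s) _)) ⟩
        sumFin (k C) (λ r → sumFin (k C) λ s → iverson (H r s) *
          countVtx n X (λ γ → ⌊ col C α γ ≟ r ⌋ ∧ ⌊ col C γ β ≟ s ⌋)) ∎
        where open ≡-Reasoning

index-∈-lookup : ∀ {A : Set} (xs : List A) i → index (∈-lookup {xs = xs} i) ≡ i
index-∈-lookup (_ ∷ _)  zero    = refl
index-∈-lookup (_ ∷ xs) (suc i) = cong suc (index-∈-lookup xs i)

-- A colouring satisfying the axioms of a coherent configuration except surjectivity becomes
-- one once each used colour is renumbered by its position in the list of used colours.
module Compress {N K : ℕ} (f : Fin N → Fin N → Fin K)
  (f-diag : ∀ a b d → f a a ≡ f b d → b ≡ d)
  (f-transp : ∀ a b a' b' → f a b ≡ f a' b' → f b a ≡ f b' a')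
  (f-regular : ∀ r s a b a' b' → f a b ≡ f a' b' →
     countFin N (λ γ → ⌊ f a γ ≟ r ⌋ ∧ ⌊ f γ b ≟ s ⌋)
       ≡ countFin N (λ γ → ⌊ f a' γ ≟ r ⌋ ∧ ⌊ f γ b' ≟ s ⌋))
  where

  InImage : Fin K → Set
  InImage v = ∃₂ λ a b → f a b ≡ v

  inImage? : Decidable InImage
  inImage? v = any? λ a → any? λ b → f a b ≟ v

  image : List (Fin K)
  image = filter inImage? (allFin K)

  index-cong : ∀ {x y} (x∈ : x ∈ image) (y∈ : y ∈ image) → x ≡ y → index x∈ ≡ index y∈
  index-cong x∈ y∈ refl =
    cong index (unique⇒irrelevant (setoid (Fin K)) (Decidable⇒UIP.≡-irrelevant _≟_)
                                  (filter⁺ inImage? (allFin⁺ K)) x∈ y∈)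

  ∈-image : ∀ a b → f a b ∈ image
  ∈-image a b = ∈-filter⁺ inImage? (∈-allFin (f a b)) (a , b , refl)

  colour : Fin N → Fin N → Fin (length image)
  colour a b = index (∈-image a b)

  colour≡⇔ : ∀ a b r → colour a b ≡ r ⇔ f a b ≡ lookup image r
  colour≡⇔ a b r = mk⇔
    (λ { refl → lookup-index (∈-image a b) })
    (λ e → trans (index-cong (∈-image a b) (∈-lookup r) e) (index-∈-lookup image r))

  colour≡colour⇔ : ∀ a b a' b' → colour a b ≡ colour a' b' ⇔ f a b ≡ f a' b'
  colour≡colour⇔ a b a' b' = mk⇔
    (λ e → trans (Equivalence.to (colour≡⇔ a b _) e) (≡-sym (lookup-index (∈-image a' b'))))
    (λ e → Equivalence.from (colour≡⇔ a b _) (trans e (lookup-index (∈-image a' b'))))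

  colour-surjective : ∀ r → ∃₂ λ a b → colour a b ≡ r
  colour-surjective r =
    let a , b , e = proj₂ (∈-filter⁻ inImage? {xs = allFin K} (∈-lookup r))
    in a , b , Equivalence.from (colour≡⇔ a b r) e

  colour-regular : ∀ r s a b a' b' → colour a b ≡ colour a' b' →
    countFin N (λ γ → ⌊ colour a γ ≟ r ⌋ ∧ ⌊ colour γ b ≟ s ⌋)
      ≡ countFin N (λ γ → ⌊ colour a' γ ≟ r ⌋ ∧ ⌊ colour γ b' ≟ s ⌋)
  colour-regular r s a b a' b' e =
    trans (via-f a b)
          (trans (f-regular _ _ a b a' b' (Equivalence.to (colour≡colour⇔ a b a' b') e))
                 (≡-sym (via-f a' b')))
    where
      via-f : ∀ a b → countFin N (λ γ → ⌊ colour a γ ≟ r ⌋ ∧ ⌊ colour γ b ≟ s ⌋)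
        ≡ countFin N (λ γ → ⌊ f a γ ≟ lookup image r ⌋ ∧ ⌊ f γ b ≟ lookup image s ⌋)
      via-f a b = sumFin-cong N λ γ → cong iverson (cong₂ _∧_
        (isYes-cong (colour a γ ≟ r) (f a γ ≟ _) (colour≡⇔ a γ r))
        (isYes-cong (colour γ b ≟ s) (f γ b ≟ _) (colour≡⇔ γ b s)))

  compressed : CC (Fin N) (countFin N)
  compressed = record
    { k       = length image
    ; col     = colour
    ; surj    = colour-surjective
    ; diag    = λ a b d e → f-diag a b d (Equivalence.to (colour≡colour⇔ a a b d) e)
    ; transp  = λ a b a' b' e → Equivalence.from (colour≡colour⇔ b a b' a')
                  (f-transp a b a' b' (Equivalence.to (colour≡colour⇔ a b a' b') e))
    ; regular = colour-regular
    }

Factors : ∀ n → (Fin n → Graph) → Set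
Factors n X = (i : Fin n) → CC (Fin (size (X i))) (countFin (size (X i)))

SameFactorColours : ∀ {n} {X : Fin n → Graph} → Factors n X → (α β α' β' : Vtx n X) → Set
SameFactorColours Cs α β α' β' =
  ∀ i → col (Cs i) (proj α i) (proj β i) ≡ col (Cs i) (proj α' i) (proj β' i)

SameFactorColours⇒AgreeOff : ∀ {n} {X : Fin n → Graph} (Cs : Factors n X) {α β α' β'} →
  SameFactorColours Cs α β α' β' → ∀ {i} → AgreeOff X i α β → AgreeOff X i α' β'
SameFactorColours⇒AgreeOff Cs {α} {β} {α'} {β'} same α≈β j j≢i =
  diag (Cs j) (proj α j) (proj α' j) (proj β' j)
       (trans (cong (col (Cs j) (proj α j)) (α≈β j j≢i)) (same j))

⊗-k : ∀ n X → Factors n X → ℕ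
⊗-k zero    X Cs = 1
⊗-k (suc n) X Cs = k (Cs zero) * ⊗-k n (X ∘ suc) (Cs ∘ suc)

⊗-col : ∀ n X (Cs : Factors n X) → Vtx n X → Vtx n X → Fin (⊗-k n X Cs)
⊗-col zero    X Cs _       _       = zero
⊗-col (suc n) X Cs (a , α) (b , β) =
  combine (col (Cs zero) a b) (⊗-col n (X ∘ suc) (Cs ∘ suc) α β)

⊗-col-injective : ∀ n X (Cs : Factors n X) α β α' β' →
  ⊗-col n X Cs α β ≡ ⊗-col n X Cs α' β' → SameFactorColours Cs α β α' β'
⊗-col-injective (suc n) X Cs (a , α) (b , β) (a' , α') (b' , β') e i
  with e₀ , e₊ ← combine-injective (col (Cs zero) a b) _ (col (Cs zero) a' b') _ e
  with i
... | zero  = e₀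
... | suc i = ⊗-col-injective n (X ∘ suc) (Cs ∘ suc) α β α' β' e₊ i

⊗-col-cong : ∀ n X (Cs : Factors n X) α β α' β' →
  SameFactorColours Cs α β α' β' → ⊗-col n X Cs α β ≡ ⊗-col n X Cs α' β'
⊗-col-cong zero    X Cs _       _       _         _         same = refl
⊗-col-cong (suc n) X Cs (a , α) (b , β) (a' , α') (b' , β') same =
  cong₂ combine (same zero) (⊗-col-cong n (X ∘ suc) (Cs ∘ suc) α β α' β' (same ∘ suc))

⊗-col-surjective : ∀ n X (Cs : Factors n X) R → ∃₂ λ α β → ⊗-col n X Cs α β ≡ R
⊗-col-surjective zero    X Cs zero = tt , tt , refl
⊗-col-surjective (suc n) X Cs R with r , R' , refl ← combine-surjective {k (Cs zero)} R =
  let a , b , e  = surj (Cs zero) r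
      α , β , e' = ⊗-col-surjective n (X ∘ suc) (Cs ∘ suc) R'
  in (a , α) , (b , β) , cong₂ combine e e'

⊗-count-step : ∀ n X (Cs : Factors (suc n) X) r R s S a α b β →
  countVtx (suc n) X (λ γ → ⌊ ⊗-col (suc n) X Cs (a , α) γ ≟ combine r R ⌋
                          ∧ ⌊ ⊗-col (suc n) X Cs γ (b , β) ≟ combine s S ⌋)
  ≡ countFin (size (X zero)) (λ c → ⌊ col (Cs zero) a c ≟ r ⌋ ∧ ⌊ col (Cs zero) c b ≟ s ⌋)
    * countVtx n (X ∘ suc) (λ γ → ⌊ ⊗-col n (X ∘ suc) (Cs ∘ suc) α γ ≟ R ⌋
                                ∧ ⌊ ⊗-col n (X ∘ suc) (Cs ∘ suc) γ β ≟ S ⌋)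
⊗-count-step n X Cs r R s S a α b β =
  trans (sumFin-cong (size (X zero)) λ c →
           trans (countVtx-cong n (X ∘ suc) λ γ →
                    trans (cong₂ _∧_ (combine-≟ (col C₀ a c) r (T α γ) R)
                                     (combine-≟ (col C₀ c b) s (T γ β) S))
                          (∧-interchange ⌊ col C₀ a c ≟ r ⌋ ⌊ T α γ ≟ R ⌋
                                         ⌊ col C₀ c b ≟ s ⌋ ⌊ T γ β ≟ S ⌋))
                 (countVtx-∧ˡ n (X ∘ suc) (⌊ col C₀ a c ≟ r ⌋ ∧ ⌊ col C₀ c b ≟ s ⌋) _))
        (sumFin-*ʳ (size (X zero)) _ _)
  where
    C₀ = Cs zero
    T  = ⊗-col n (X ∘ suc) (Cs ∘ suc)

⊗-regular : ∀ n X (Cs : Factors n X) R S α β α' β' →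
  ⊗-col n X Cs α β ≡ ⊗-col n X Cs α' β' →
  countVtx n X (λ γ → ⌊ ⊗-col n X Cs α γ ≟ R ⌋ ∧ ⌊ ⊗-col n X Cs γ β ≟ S ⌋)
  ≡ countVtx n X (λ γ → ⌊ ⊗-col n X Cs α' γ ≟ R ⌋ ∧ ⌊ ⊗-col n X Cs γ β' ≟ S ⌋)
⊗-regular zero X Cs R S α β α' β' e = refl
⊗-regular (suc n) X Cs R S (a , α) (b , β) (a' , α') (b' , β') e
  with r , R' , refl ← combine-surjective {k (Cs zero)} R
     | s , S' , refl ← combine-surjective {k (Cs zero)} S
     | e₀ , e₊ ← combine-injective (col (Cs zero) a b) _ (col (Cs zero) a' b') _ e =
  trans (⊗-count-step n X Cs r R' s S' a α b β)
        (trans (cong₂ _*_ (regular (Cs zero) r s a b a' b' e₀)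
                          (⊗-regular n (X ∘ suc) (Cs ∘ suc) R' S' α β α' β' e₊))
               (≡-sym (⊗-count-step n X Cs r R' s S' a' α' b' β')))

tensor : ∀ n X → Factors n X → CC (Vtx n X) (countVtx n X)
tensor n X Cs = record
  { k       = ⊗-k n X Cs
  ; col     = ⊗-col n X Cs
  ; surj    = ⊗-col-surjective n X Cs
  ; diag    = λ α β δ e → proj-ext λ j →
                diag (Cs j) (proj α j) (proj β j) (proj δ j) (⊗-col-injective n X Cs α α β δ e j)
  ; transp  = λ α β α' β' e → ⊗-col-cong n X Cs β α β' α' λ j →
                transp (Cs j) _ _ _ _ (⊗-col-injective n X Cs α β α' β' e j)
  ; regular = ⊗-regular n X Cs
  }

BoxEdges-isRelation : ∀ n X (Cs : Factors n X) → (∀ i → IsRelation (Cs i) (E (X i))) →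
  IsRelation (tensor n X Cs) (BoxEdges X)
BoxEdges-isRelation n X Cs E-rel α β α' β' e (i , αβ , α≈β) =
  i , E-rel i _ _ _ _ (same i) αβ , SameFactorColours⇒AgreeOff Cs same α≈β
  where same = ⊗-col-injective n X Cs α β α' β' e

tensor⇒parabolic : ∀ {n} {X : Fin n → Graph} (C : CC (Vtx n X) (countVtx n X))
  (Cs : Factors n X) → (∀ i → Connected (X i)) → TensorEq C Cs →
  ∀ i → IsParabolic C (EqClosure (c X i))
tensor⇒parabolic C Cs conn tensorEq i =
  isEquivalence (c _ i) ,
  IsRelation-map C (AgreeOff⇒EqClosure-c (conn i)) EqClosure-c⇒AgreeOff
    λ α β α' β' e → SameFactorColours⇒AgreeOff Cs (proj₁ (tensorEq α β α' β') e)

module Quotient {n} {X : Fin n → Graph} (C : CC (Vtx n X) (countVtx n X)) (i : Fin n)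
  (agreeAt-isRelation : IsRelation C (λ α β → proj α i ≡ proj β i)) (α₀ : Vtx n X) where

  LiesOver : Fin (size (X i)) → Fin (size (X i)) → Vtx n X → Vtx n X → Set
  LiesOver a b α β = proj α i ≡ a × proj β i ≡ b

  ColourOver : Fin (size (X i)) → Fin (size (X i)) → Fin (k C) → Set
  ColourOver a b u = ∃₂ λ α β → LiesOver a b α β × col C α β ≡ u

  colourOver? : ∀ a b → Decidable (ColourOver a b)
  colourOver? a b u =
    ∃Vtx? λ α → ∃Vtx? λ β → (proj α i ≟ a ×-dec proj β i ≟ b) ×-dec col C α β ≟ u

  colourOver-transfer : ∀ {a b a' b'} α β α' β' → LiesOver a b α β → LiesOver a' b' α' β' →
    col C α β ≡ col C α' β' → ∀ {u} → ColourOver a b u → ColourOver a' b' u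
  colourOver-transfer α β α' β' (refl , refl) (refl , refl) e (γ , δ , (γ-over , δ-over) , refl) =
    let δ' , α'δ'≡αδ , δ'β'≡δβ = same-colour-triangle C α β α' β' e δ
        γ' , α'γ'≡αγ , γ'δ'≡γδ = same-colour-triangle C α δ α' δ' (≡-sym α'δ'≡αδ) γ
    in γ' , δ' , ( ≡-sym (agreeAt-isRelation α γ α' γ' (≡-sym α'γ'≡αγ) (≡-sym γ-over))
                 , agreeAt-isRelation δ β δ' β' (≡-sym δ'β'≡δβ) δ-over )
            , γ'δ'≡γδ

  -- The quotient colour of (a, b) is the set of colours of pairs lying over (a, b). By
  -- colourOver-transfer two such sets are equal or disjoint, so each is determined by its least
  -- element (the value fromℕ (k C) for the empty set never occurs).
  qcol : Fin (size (X i)) → Fin (size (X i)) → Fin (suc (k C))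
  qcol a b = least (colourOver? a b)

  qcol-cong : ∀ {a b a' b'} α β α' β' → LiesOver a b α β → LiesOver a' b' α' β' →
    col C α β ≡ col C α' β' → qcol a b ≡ qcol a' b'
  qcol-cong α β α' β' over over' e = least-cong (colourOver? _ _) (colourOver? _ _) λ u →
    mk⇔ (colourOver-transfer α β α' β' over over' e)
        (colourOver-transfer α' β' α β over' over (≡-sym e))

  lift : Fin (size (X i)) → Vtx n X
  lift a = update α₀ i a

  lift-over : ∀ a b → LiesOver a b (lift a) (lift b)
  lift-over a b = proj-update-≡ α₀ i a , proj-update-≡ α₀ i b

  lift-colourOver : ∀ a b → ColourOver a b (col C (lift a) (lift b))
  lift-colourOver a b = lift a , lift b , lift-over a b , refl

  qcol-least : ∀ a b → ∃ λ v → qcol a b ≡ inject₁ v × ColourOver a b v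
  qcol-least a b = least-satisfies (colourOver? a b) (lift-colourOver a b)

  qcol-transfer : ∀ {a b a' b'} → qcol a b ≡ qcol a' b' →
    ColourOver a' b' (col C (lift a) (lift b))
  qcol-transfer {a} {b} {a'} {b'} e =
    let v  , q≡v   , α  , β  , over  , αβ≡v   = qcol-least a b
        v' , q'≡v' , α' , β' , over' , α'β'≡v' = qcol-least a' b'
        v≡v' = inject₁-injective (trans (≡-sym q≡v) (trans e q'≡v'))
    in colourOver-transfer α β α' β' over over' (trans αβ≡v (trans v≡v' (≡-sym α'β'≡v')))
                           (lift-colourOver a b)

  qcol-diag : ∀ a b d → qcol a a ≡ qcol b d → b ≡ d
  qcol-diag a b d e with qcol-transfer e
  ... | γ , δ , (refl , refl) , γδ≡aa =
    agreeAt-isRelation (lift a) (lift a) γ δ (≡-sym γδ≡aa) refl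

  qcol-transp : ∀ a b a' b' → qcol a b ≡ qcol a' b' → qcol b a ≡ qcol b' a'
  qcol-transp a b a' b' e with qcol-transfer e
  ... | γ , δ , (γ-over , δ-over) , γδ≡ab =
    qcol-cong (lift b) (lift a) δ γ (lift-over b a) (δ-over , γ-over)
              (≡-sym (transp C γ δ (lift a) (lift b) γδ≡ab))

  κ : Fin (k C) → Fin (suc (k C))
  κ u = let x , y , _ = surj C u in qcol (proj x i) (proj y i)

  qcol≡κ : ∀ α β → qcol (proj α i) (proj β i) ≡ κ (col C α β)
  qcol≡κ α β = let x , y , e = surj C (col C α β) in
    qcol-cong α β x y (refl , refl) (refl , refl) (≡-sym e)

  qcol-count : ∀ r s {a b} α β → LiesOver a b α β →
    fibreSize n X i * countFin (size (X i)) (λ c → ⌊ qcol a c ≟ r ⌋ ∧ ⌊ qcol c b ≟ s ⌋)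
    ≡ countVtx n X (λ γ → ⌊ κ (col C α γ) ≟ r ⌋ ∧ ⌊ κ (col C γ β) ≟ s ⌋)
  qcol-count r s α β (refl , refl) =
    trans (≡-sym (countVtx-proj n X i _)) (countVtx-cong n X λ γ →
      cong₂ _∧_ (cong (λ q → ⌊ q ≟ r ⌋) (qcol≡κ α γ))
                (cong (λ q → ⌊ q ≟ s ⌋) (qcol≡κ γ β)))

  qcol-regular : ∀ r s a b a' b' → qcol a b ≡ qcol a' b' →
    countFin (size (X i)) (λ c → ⌊ qcol a c ≟ r ⌋ ∧ ⌊ qcol c b ≟ s ⌋)
    ≡ countFin (size (X i)) (λ c → ⌊ qcol a' c ≟ r ⌋ ∧ ⌊ qcol c b' ≟ s ⌋)
  qcol-regular r s a b a' b' e with qcol-transfer e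
  ... | γ , δ , over , γδ≡ab =
    *-cancelˡ-≡ _ _ (fibreSize n X i) {{fibreSize-nonZero n X i α₀}} $′
    trans (qcol-count r s (lift a) (lift b) (lift-over a b)) $′
    trans (regular-by-colours C (lift a) (lift b) γ δ (≡-sym γδ≡ab)
                              λ u v → ⌊ κ u ≟ r ⌋ ∧ ⌊ κ v ≟ s ⌋)
          (≡-sym (qcol-count r s γ δ over))

  open Compress qcol qcol-diag qcol-transp qcol-regular using (colour≡colour⇔)

  quotient : CC (Fin (size (X i))) (countFin (size (X i)))
  quotient = Compress.compressed qcol qcol-diag qcol-transp qcol-regular

  quotient-col-cong : ∀ α β α' β' → col C α β ≡ col C α' β' →
    col quotient (proj α i) (proj β i) ≡ col quotient (proj α' i) (proj β' i)
  quotient-col-cong α β α' β' e =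
    Equivalence.from (colour≡colour⇔ _ _ _ _) (qcol-cong α β α' β' (refl , refl) (refl , refl) e)

  quotient-isRelation : ∀ {Q : Vtx n X → Vtx n X → Set}
    {R : Fin (size (X i)) → Fin (size (X i)) → Set} → IsRelation C Q →
    (∀ {a b} → R a b → Q (lift a) (lift b)) →
    (∀ {α β} → Q α β → R (proj α i) (proj β i)) → IsRelation quotient R
  quotient-isRelation Q-rel R⇒Q Q⇒R a b a' b' e Rab
    with qcol-transfer (Equivalence.to (colour≡colour⇔ a b a' b') e)
  ... | γ , δ , (refl , refl) , γδ≡ab =
    Q⇒R (Q-rel (lift a) (lift b) γ δ (≡-sym γδ≡ab) (R⇒Q Rab))

module _ {n} {X : Fin n → Graph} (C : CC (Vtx n X) (countVtx n X)) where

  AgreeOff⇒AgreeAt-isRelation : (∀ j → IsRelation C (AgreeOff X j)) →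
    ∀ i → IsRelation C (λ α β → proj α i ≡ proj β i)
  AgreeOff⇒AgreeAt-isRelation agreeOff-rel i =
    IsRelation-map C Star⇒agreeAt agreeAt⇒Star (Star-isRelation C AgreeOffOther-isRelation)
    where
      AgreeOffOther : Vtx n X → Vtx n X → Set
      AgreeOffOther x y = ∃ λ j → j ≢ i × AgreeOff X j x y

      AgreeOffOther-isRelation : IsRelation C AgreeOffOther
      AgreeOffOther-isRelation α β α' β' e (j , j≢i , α≈β) =
        j , j≢i , agreeOff-rel j α β α' β' e α≈β

      Star⇒agreeAt : ∀ {x y} → Star AgreeOffOther x y → proj x i ≡ proj y i
      Star⇒agreeAt ε                        = refl
      Star⇒agreeAt ((j , j≢i , x≈z) ◅ z~y) =
        trans (x≈z i (j≢i ∘ ≡-sym)) (Star⇒agreeAt z~y)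

      agreeAt⇒Star : ∀ {x y} → proj x i ≡ proj y i → Star AgreeOffOther x y
      agreeAt⇒Star {x} {y} xᵢ≡yᵢ =
        gmap id (λ (j , xⱼ≢yⱼ , s≈t) → j , differs⇒≢i xⱼ≢yⱼ , s≈t)
                (coordinatewise-path n X x y)
        where
          differs⇒≢i : ∀ {j} → proj x j ≢ proj y j → j ≢ i
          differs⇒≢i xⱼ≢yⱼ refl = xⱼ≢yⱼ xᵢ≡yᵢ

  -- An X-edge in direction j ≠ i joining the ends of a pair in ⟨c_i⟩ would be a loop of X_j.
  c-isRelation : IsRelation C (BoxEdges X) → ∀ {i} → IsRelation C (AgreeOff X i) →
    IsRelation C (c X i)
  c-isRelation box-rel {i} agreeOff-rel α β α' β' e αβ with box-rel α β α' β' e (i , αβ)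
  ... | j , α'β' with j ≟ i
  ...   | yes refl = α'β'
  ...   | no j≢i   = ⊥-elim (irrefl (X j) (proj α' j) (subst (E (X j) (proj α' j))
                       (≡-sym (agreeOff-rel α β α' β' e (proj₂ αβ) j j≢i)) (proj₁ α'β')))

  parabolics⇒SameFactorColours : (Cs : Factors n X) → (∀ i → Connected (X i)) →
    IsRelation C (BoxEdges X) → (∀ i → IsWL (Cs i) (E (X i))) →
    (∀ i → IsParabolic C (EqClosure (c X i))) →
    ∀ α β α' β' → col C α β ≡ col C α' β' → SameFactorColours Cs α β α' β'
  parabolics⇒SameFactorColours Cs conn box-rel wls parabolic α β α' β' e i =
    WL-refines (Cs i) quotient (wls i)
      (quotient-isRelation (c-isRelation box-rel (agreeOff-rel i)) (update-c α i) proj₁)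
      _ _ _ _ (quotient-col-cong α β α' β' e)
    where
      agreeOff-rel : ∀ j → IsRelation C (AgreeOff X j)
      agreeOff-rel j = IsRelation-map C EqClosure-c⇒AgreeOff (AgreeOff⇒EqClosure-c (conn j))
                                      (proj₂ (parabolic j))
      open Quotient C i (AgreeOff⇒AgreeAt-isRelation agreeOff-rel i) α

lemma5p1 : (n : ℕ) (X : Fin n → Graph) → (∀ i → Connected (X i)) →
    (C : CC (Vtx n X) (countVtx n X)) → IsWL C (BoxEdges X) →
    (Cs : (i : Fin n) → CC (Fin (size (X i))) (countFin (size (X i)))) →
    (∀ i → IsWL (Cs i) (E (X i))) →
    (TensorEq C Cs ⇔ (∀ i → IsParabolic C (EqClosure (c X i))))
lemma5p1 n X conn C wl Cs wls = mk⇔ (tensor⇒parabolic C Cs conn) parabolics⇒tensor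
  where
    parabolics⇒tensor : (∀ i → IsParabolic C (EqClosure (c X i))) → TensorEq C Cs
    parabolics⇒tensor parabolic α β α' β' =
        parabolics⇒SameFactorColours C Cs conn (proj₁ wl) wls parabolic α β α' β'
      , WL-refines C (tensor n X Cs) wl (BoxEdges-isRelation n X Cs (proj₁ ∘ wls)) α β α' β'
        ∘ ⊗-col-cong n X Cs α β α' β'
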